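{- (1) If $M:\langle\Gamma\vdash U\rangle$, then $dom(\Gamma)=FV(M)$. (2) For every environment $\Gamma$ and term $M$ with $dom(\Gamma)=FV(M)$, we have $M:\langle\Gamma\vdash\omega\rangle$.
   Context: Terms: $\mathcal V$ is a denumerably infinite set of variables; $\mathcal M$ is the set of untyped $\lambda$-terms $M::=x\mid \lambda x.M\mid MM$ taken modulo $\alpha$-conversion; $FV(M)$ is the set of free variables. Types: $\mathcal A$ is a denumerably infinite set of atomic types; $\mathbb T::=a\mid \mathbb U\to\mathbb T$ ($a\in\mathcal A$) and $\mathbb U::=\omega\mid \mathbb U\sqcap\mathbb U\mid \mathbb T$; types are quotiented by commutativity, associativity and idempotence of $\sqcap$ and by $\omega\sqcap U=U$. $T$ ranges over $\mathbb T$, $U,V$ over $\mathbb U$. Environments: a type environment is a finite set $(x_i:U_i)_n$ of declarations with pairwise distinct variables; $dom$ is its set of variables; $\Gamma,x:U$ requires $x\notin dom(\Gamma)$; $env^M_\omega$ assigns $\omega$ to each variable of $FV(M)$ and nothing else; if $\Gamma_1=(x_i:U_i)_n,(y_j:V_j)_m$ and $\Gamma_2=(x_i:U'_i)_n,(z_k:W_k)_l$ with the $y_j$, $z_k$ all distinct, then $\Gamma_1\sqcap\Gamma_2=(x_i:U_i\sqcap U'_i)_n,(y_j:V_j)_m,(z_k:W_k)_l$. Subtyping: $\sqsubseteq$ (on types, on environments, and on typings $\langle\Gamma\vdash U\rangle$) is the least relation closed under: $\Phi\sqsubseteq\Phi$; transitivity; $U_1\sqcap U_2\sqsubseteq U_1$;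 if $U_1\sqsubseteq V_1$ and $U_2\sqsubseteq V_2$ then $U_1\sqcap U_2\sqsubseteq V_1\sqcap V_2$; if $U_2\sqsubseteq U_1$ and $T_1\sqsubseteq T_2$ then $U_1\to T_1\sqsubseteq U_2\to T_2$; if $U_1\sqsubseteq U_2$ and $x\notin dom(\Gamma)$ then $\Gamma,x:U_1\sqsubseteq\Gamma,x:U_2$; if $U_1\sqsubseteq U_2$ and $\Gamma_2\sqsubseteq\Gamma_1$ then $\langle\Gamma_1\vdash U_1\rangle\sqsubseteq\langle\Gamma_2\vdash U_2\rangle$. Typing rules for $M:\langle\Gamma\vdash U\rangle$: (ax) $x:\langle x:T\vdash T\rangle$ for $T\in\mathbb T$; ($\omega$) $M:\langle env^M_\omega\vdash\omega\rangle$; ($\to_i$) from $M:\langle\Gamma,x:U\vdash T\rangle$ infer $\lambda x.M:\langle\Gamma\vdash U\to T\rangle$; ($\to'_i$) from $M:\langle\Gamma\vdash T\rangle$ and $x\notin dom(\Gamma)$ infer $\lambda x.M:\langle\Gamma\vdash\omega\to T\rangle$; ($\to_e$) from $M_1:\langle\Gamma_1\vdash U\to T\rangle$ and $M_2:\langle\Gamma_2\vdash U\rangle$ infer $M_1M_2:\langle\Gamma_1\sqcap\Gamma_2\vdash T\rangle$; ($\sqcap_i$) from $M:\langle\Gamma\vdash U_1\rangle$ and $M:\langle\Gamma\vdash U_2\rangle$ infer $M:\langle\Gamma\vdash U_1\sqcap U_2\rangle$; ($\sqsubseteq$) from $M:\langle\Gamma\vdash U\rangle$ and $\langle\Gamma\vdash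 U\rangle\sqsubseteq\langle\Gamma'\vdash U'\rangle$ infer $M:\langle\Gamma'\vdash U'\rangle$. -}

module Defs where

open import Data.Nat using (ℕ; _≟_)
open import Data.List using (List; []; _∷_; _++_; map; filter; deduplicate)
open import Data.List.Membership.Propositional using (_∈_; _∉_)
open import Data.List.Relation.Binary.Permutation.Propositional using (_↭_)
open import Data.Product using (_×_; _,_; proj₁)
open import Data.Maybe using (Maybe; just; nothing)
open import Relation.Nullary using (yes; no; ¬?)

Var : Set
Var = ℕ

Atom : Set
Atom = ℕ

data Term : Set where
  var : Var → Term
  lam : Var → Term → Term
  app : Term → Term → Term

-- Free variables (as a list; only membership matters).
FV : Term → List Var
FV (var x)   = x ∷ []
FV (lam x M) = filter (λ y → ¬? (y ≟ x)) (FV M)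
FV (app M N) = FV M ++ FV N

mutual
  data TT : Set where
    atom : Atom → TT
    _⇒_  : UU → TT → TT

  data UU : Set where
    ω   : UU
    _⊓_ : UU → UU → UU
    ↑   : TT → UU

infixr 7 _⇒_
infixl 8 _⊓_

data _≈_ : UU → UU → Set where
  ≈-refl  : ∀ {U} → U ≈ U
  ≈-sym   : ∀ {U V} → U ≈ V → V ≈ U
  ≈-trans : ∀ {U V W} → U ≈ V → V ≈ W → U ≈ W
  ⊓-comm  : ∀ {U V} → (U ⊓ V) ≈ (V ⊓ U)
  ⊓-assoc : ∀ {U V W} → ((U ⊓ V) ⊓ W) ≈ (U ⊓ (V ⊓ W))
  ⊓-idem  : ∀ {U} → (U ⊓ U) ≈ U
  ω-unit  : ∀ {U} → (ω ⊓ U) ≈ U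
  ⊓-cong  : ∀ {U U' V V'} → U ≈ U' → V ≈ V' → (U ⊓ V) ≈ (U' ⊓ V')
  ⇒-cong  : ∀ {U U' T T'} → U ≈ U' → ↑ T ≈ ↑ T' → ↑ (U ⇒ T) ≈ ↑ (U' ⇒ T')

-- Type environments: lists of declarations (pairwise distinct variables
-- in well-formed environments), considered up to permutation.
Env : Set
Env = List (Var × UU)

dom : Env → List Var
dom Γ = map proj₁ Γ

lookupᴱ : Env → Var → Maybe UU
lookupᴱ [] x = nothing
lookupᴱ ((y , U) ∷ Γ) x with x ≟ y
... | yes _ = just U
... | no _  = lookupᴱ Γ x

envω : Term → Env
envω M = map (λ x → (x , ω)) (deduplicate _≟_ (FV M))

mergeDecl : Env → Var × UU → Var × UU
mergeDecl Γ₂ (x , U) with lookupᴱ Γ₂ x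
... | just U' = (x , U ⊓ U')
... | nothing = (x , U)

restᴱ : Env → Env → Env
restᴱ Γ₁ [] = []
restᴱ Γ₁ ((z , W) ∷ Γ₂) with lookupᴱ Γ₁ z
... | just _  = restᴱ Γ₁ Γ₂
... | nothing = (z , W) ∷ restᴱ Γ₁ Γ₂

_⊓ᴱ_ : Env → Env → Env
Γ₁ ⊓ᴱ Γ₂ = map (mergeDecl Γ₂) Γ₁ ++ restᴱ Γ₁ Γ₂

data _⊑_ : UU → UU → Set where
  ⊑-refl  : ∀ {U V} → U ≈ V → U ⊑ V
  ⊑-trans : ∀ {U V W} → U ⊑ V → V ⊑ W → U ⊑ W
  ⊑-⊓     : ∀ {U₁ U₂} → (U₁ ⊓ U₂) ⊑ U₁
  ⊑-⊓mono : ∀ {U₁ U₂ V₁ V₂} → U₁ ⊑ V₁ → U₂ ⊑ V₂ → (U₁ ⊓ U₂) ⊑ (V₁ ⊓ V₂)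
  ⊑-⇒     : ∀ {U₁ U₂ T₁ T₂} → U₂ ⊑ U₁ → ↑ T₁ ⊑ ↑ T₂ → ↑ (U₁ ⇒ T₁) ⊑ ↑ (U₂ ⇒ T₂)

data _⊑ᴱ_ : Env → Env → Set where
  ⊑ᴱ-refl  : ∀ {Γ Γ'} → Γ ↭ Γ' → Γ ⊑ᴱ Γ'
  ⊑ᴱ-trans : ∀ {Γ₁ Γ₂ Γ₃} → Γ₁ ⊑ᴱ Γ₂ → Γ₂ ⊑ᴱ Γ₃ → Γ₁ ⊑ᴱ Γ₃
  ⊑ᴱ-ext   : ∀ {Γ x U₁ U₂} → U₁ ⊑ U₂ → x ∉ dom Γ →
             ((x , U₁) ∷ Γ) ⊑ᴱ ((x , U₂) ∷ Γ)

record Typing : Set where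
  constructor ⟨_⊢_⟩
  field
    env : Env
    ty  : UU

data _⊑ᵀ_ : Typing → Typing → Set where
  ⊑ᵀ-refl  : ∀ {Γ Γ' U U'} → Γ ↭ Γ' → U ≈ U' → ⟨ Γ ⊢ U ⟩ ⊑ᵀ ⟨ Γ' ⊢ U' ⟩
  ⊑ᵀ-trans : ∀ {Φ₁ Φ₂ Φ₃} → Φ₁ ⊑ᵀ Φ₂ → Φ₂ ⊑ᵀ Φ₃ → Φ₁ ⊑ᵀ Φ₃
  ⊑ᵀ-⊢     : ∀ {Γ₁ Γ₂ U₁ U₂} → U₁ ⊑ U₂ → Γ₂ ⊑ᴱ Γ₁ → ⟨ Γ₁ ⊢ U₁ ⟩ ⊑ᵀ ⟨ Γ₂ ⊢ U₂ ⟩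

data _∶_ : Term → Typing → Set where
  ax   : ∀ {x T} → var x ∶ ⟨ (x , ↑ T) ∷ [] ⊢ ↑ T ⟩
  ω-ty : ∀ {M} → M ∶ ⟨ envω M ⊢ ω ⟩
  →i   : ∀ {M Γ x U T} → x ∉ dom Γ → M ∶ ⟨ (x , U) ∷ Γ ⊢ ↑ T ⟩ →
         lam x M ∶ ⟨ Γ ⊢ ↑ (U ⇒ T) ⟩
  →i'  : ∀ {M Γ x T} → M ∶ ⟨ Γ ⊢ ↑ T ⟩ → x ∉ dom Γ →
         lam x M ∶ ⟨ Γ ⊢ ↑ (ω ⇒ T) ⟩
  →e   : ∀ {M₁ M₂ Γ₁ Γ₂ U T} → M₁ ∶ ⟨ Γ₁ ⊢ ↑ (U ⇒ T) ⟩ → M₂ ∶ ⟨ Γ₂ ⊢ U ⟩ →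
         app M₁ M₂ ∶ ⟨ Γ₁ ⊓ᴱ Γ₂ ⊢ ↑ T ⟩
  ⊓i   : ∀ {M Γ U₁ U₂} → M ∶ ⟨ Γ ⊢ U₁ ⟩ → M ∶ ⟨ Γ ⊢ U₂ ⟩ → M ∶ ⟨ Γ ⊢ U₁ ⊓ U₂ ⟩
  sub  : ∀ {M Φ Φ'} → M ∶ Φ → Φ ⊑ᵀ Φ' → M ∶ Φ'

_≐_ : List Var → List Var → Set
xs ≐ ys = (∀ x → x ∈ xs → x ∈ ys) × (∀ x → x ∈ ys → x ∈ xs)

module Submission where

-- Part (1) is an induction on the typing derivation.  Its ingredients are
-- the domain bookkeeping for each construction: subtyping of environments
-- and typings leaves domains unchanged, dom (env^M_ω) = FV M, the domain of
-- Γ₁ ⊓ Γ₂ is dom Γ₁ ∪ dom Γ₂, and binding a fresh x removes x from FV M.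
--
-- Part (2) starts from the axiom M : ⟨env^M_ω ⊢ ω⟩ and uses subsumption.
-- Since typings are contravariant in the environment it suffices to show
-- Γ ⊑ env^M_ω.  Every declaration x : U can be weakened to x : ω (because
-- U ⊑ ω ⊓ U ⊑ ω), and weakening is a congruence for fresh declarations, so
-- Γ ⊑ ωify Γ, the environment assigning ω to each variable of Γ; finally
-- ωify Γ is a permutation of env^M_ω, both lists being duplicate-free with
-- the same elements.

open import Defs
open import Data.Nat using (_≟_)
open import Data.Product using (_×_; _,_; proj₁; proj₂)
open import Data.Sum using (_⊎_; inj₁; inj₂; [_,_])
open import Data.Empty using (⊥-elim)
open import Data.Maybe using (just; nothing)
open import Data.List using (List; []; _∷_; _++_; map; deduplicate)
open import Data.List.Properties using (map-++)
open import Data.List.Relation.Unary.Any using (here; there)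
open import Data.List.Relation.Unary.All.Properties using (All¬⇒¬Any)
open import Data.List.Relation.Unary.AllPairs using (_∷_)
open import Data.List.Relation.Unary.Unique.Propositional using (Unique)
open import Data.List.Relation.Unary.Unique.DecPropositional.Properties _≟_ using (deduplicate-!)
open import Data.List.Membership.Propositional using (_∈_; _∉_)
open import Data.List.Membership.Propositional.Properties
  using (∈-++⁺ˡ; ∈-++⁺ʳ; ∈-++⁻; ∈-filter⁺; ∈-filter⁻; ∈-deduplicate⁺; ∈-deduplicate⁻)
open import Data.List.Membership.Propositional.Properties.WithK using (unique∧set⇒bag)
open import Data.List.Relation.Binary.Subset.Propositional.Properties using (++⁺)
open import Data.List.Relation.Binary.BagAndSetEquality using (∼bag⇒↭)
open import Data.List.Relation.Binary.Permutation.Propositional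
  using (_↭_; ↭-refl; ↭-sym; prep; swap)
open import Data.List.Relation.Binary.Permutation.Propositional.Properties using (∈-resp-↭; map⁺)
open import Function.Bundles using (_⇔_; mk⇔)
open import Relation.Nullary using (yes; no; ¬?)
open import Relation.Binary.PropositionalEquality using (_≡_; refl; sym; cong)
open Relation.Binary.PropositionalEquality.≡-Reasoning

≐-refl : ∀ {xs} → xs ≐ xs
≐-refl = (λ _ p → p) , (λ _ p → p)

≐-sym : ∀ {xs ys} → xs ≐ ys → ys ≐ xs
≐-sym (f , g) = g , f

≐-trans : ∀ {xs ys zs} → xs ≐ ys → ys ≐ zs → xs ≐ zs
≐-trans (f , g) (h , k) = (λ x p → h x (f x p)) , (λ x p → g x (k x p))

≐-++ : ∀ {xs ys us vs} → xs ≐ ys → us ≐ vs → (xs ++ us) ≐ (ys ++ vs)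
≐-++ (f , g) (h , k) =
  (λ _ → ++⁺ (λ {y} → f y) (λ {y} → h y)) , (λ _ → ++⁺ (λ {y} → g y) (λ {y} → k y))

↭⇒≐ : ∀ {xs ys} → xs ↭ ys → xs ≐ ys
↭⇒≐ p = (λ _ q → ∈-resp-↭ p q) , (λ _ q → ∈-resp-↭ (↭-sym p) q)

dom-↭ : ∀ {Γ Γ'} → Γ ↭ Γ' → dom Γ ≐ dom Γ'
dom-↭ p = ↭⇒≐ (map⁺ proj₁ p)

dom-⊑ᴱ : ∀ {Γ Γ'} → Γ ⊑ᴱ Γ' → dom Γ ≐ dom Γ'
dom-⊑ᴱ (⊑ᴱ-refl p)    = dom-↭ p
dom-⊑ᴱ (⊑ᴱ-trans p q) = ≐-trans (dom-⊑ᴱ p) (dom-⊑ᴱ q)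
dom-⊑ᴱ (⊑ᴱ-ext _ _)   = ≐-refl

dom-⊑ᵀ : ∀ {Φ Φ'} → Φ ⊑ᵀ Φ' → dom (Typing.env Φ) ≐ dom (Typing.env Φ')
dom-⊑ᵀ (⊑ᵀ-refl p _)  = dom-↭ p
dom-⊑ᵀ (⊑ᵀ-trans p q) = ≐-trans (dom-⊑ᵀ p) (dom-⊑ᵀ q)
dom-⊑ᵀ (⊑ᵀ-⊢ _ q)     = ≐-sym (dom-⊑ᴱ q)

ωify : List Var → Env
ωify xs = map (λ x → (x , ω)) xs

dom-ωify : ∀ xs → dom (ωify xs) ≡ xs
dom-ωify []       = refl
dom-ωify (x ∷ xs) = cong (x ∷_) (dom-ωify xs)

dom-envω : ∀ M → dom (envω M) ≐ FV M
dom-envω M rewrite dom-ωify (deduplicate _≟_ (FV M)) =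
  (λ _ p → ∈-deduplicate⁻ _≟_ (FV M) p) , (λ _ p → ∈-deduplicate⁺ _≟_ p)

-- The domain of Γ₁ ⊓ Γ₂ is dom Γ₁ ∪ dom Γ₂: the merged part has domain
-- dom Γ₁, and the rest consists of the declarations of Γ₂ outside dom Γ₁.

dom-merge : ∀ Γ₁ Γ₂ → dom (map (mergeDecl Γ₂) Γ₁) ≡ dom Γ₁
dom-merge [] Γ₂ = refl
dom-merge ((x , U) ∷ Γ₁) Γ₂ with lookupᴱ Γ₂ x
... | just _  = cong (x ∷_) (dom-merge Γ₁ Γ₂)
... | nothing = cong (x ∷_) (dom-merge Γ₁ Γ₂)

lookup⇒∈ : ∀ Γ z {U} → lookupᴱ Γ z ≡ just U → z ∈ dom Γ
lookup⇒∈ ((y , V) ∷ Γ) z eq with z ≟ y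
... | yes z≡y = here z≡y
... | no _    = there (lookup⇒∈ Γ z eq)

rest-sound : ∀ Γ₁ Γ₂ {y} → y ∈ dom (restᴱ Γ₁ Γ₂) → y ∈ dom Γ₂
rest-sound Γ₁ ((z , W) ∷ Γ₂) p with lookupᴱ Γ₁ z
rest-sound Γ₁ ((z , W) ∷ Γ₂) p         | just _  = there (rest-sound Γ₁ Γ₂ p)
rest-sound Γ₁ ((z , W) ∷ Γ₂) (here q)  | nothing = here q
rest-sound Γ₁ ((z , W) ∷ Γ₂) (there p) | nothing = there (rest-sound Γ₁ Γ₂ p)

rest-complete : ∀ Γ₁ Γ₂ {y} → y ∈ dom Γ₂ → y ∈ dom Γ₁ ⊎ y ∈ dom (restᴱ Γ₁ Γ₂)
rest-complete Γ₁ ((z , W) ∷ Γ₂) p with lookupᴱ Γ₁ z in eq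
rest-complete Γ₁ ((z , W) ∷ Γ₂) (here refl) | just _  = inj₁ (lookup⇒∈ Γ₁ z eq)
rest-complete Γ₁ ((z , W) ∷ Γ₂) (there p)   | just _  = rest-complete Γ₁ Γ₂ p
rest-complete Γ₁ ((z , W) ∷ Γ₂) (here q)    | nothing = inj₂ (here q)
rest-complete Γ₁ ((z , W) ∷ Γ₂) (there p)   | nothing =
  [ inj₁ , (λ r → inj₂ (there r)) ] (rest-complete Γ₁ Γ₂ p)

dom-⊓ᴱ≡ : ∀ Γ₁ Γ₂ → dom (Γ₁ ⊓ᴱ Γ₂) ≡ dom Γ₁ ++ dom (restᴱ Γ₁ Γ₂)
dom-⊓ᴱ≡ Γ₁ Γ₂ = begin
  dom (map (mergeDecl Γ₂) Γ₁ ++ restᴱ Γ₁ Γ₂)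
    ≡⟨ map-++ proj₁ (map (mergeDecl Γ₂) Γ₁) (restᴱ Γ₁ Γ₂) ⟩
  dom (map (mergeDecl Γ₂) Γ₁) ++ dom (restᴱ Γ₁ Γ₂)
    ≡⟨ cong (_++ dom (restᴱ Γ₁ Γ₂)) (dom-merge Γ₁ Γ₂) ⟩
  dom Γ₁ ++ dom (restᴱ Γ₁ Γ₂) ∎

dom-⊓ᴱ : ∀ Γ₁ Γ₂ → dom (Γ₁ ⊓ᴱ Γ₂) ≐ (dom Γ₁ ++ dom Γ₂)
dom-⊓ᴱ Γ₁ Γ₂ rewrite dom-⊓ᴱ≡ Γ₁ Γ₂ = to , from
  where
  to : ∀ y → y ∈ dom Γ₁ ++ dom (restᴱ Γ₁ Γ₂) → y ∈ dom Γ₁ ++ dom Γ₂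
  to _ = ++⁺ (λ p → p) (rest-sound Γ₁ Γ₂)

  from : ∀ y → y ∈ dom Γ₁ ++ dom Γ₂ → y ∈ dom Γ₁ ++ dom (restᴱ Γ₁ Γ₂)
  from y p with ∈-++⁻ (dom Γ₁) p
  ... | inj₁ q = ∈-++⁺ˡ q
  ... | inj₂ q = [ ∈-++⁺ˡ , ∈-++⁺ʳ (dom Γ₁) ] (rest-complete Γ₁ Γ₂ q)

-- Abstraction: if xs (not containing x) lies between FV M minus x and FV M,
-- then xs is exactly FV (λx.M).  Covers both (→i), where dom of the premise
-- is x ∷ xs, and (→'i), where it is xs.

dom-lam : ∀ x M {xs} → x ∉ xs → (∀ y → y ∈ xs → y ∈ FV M) →
          (∀ y → y ∈ FV M → y ∈ x ∷ xs) → xs ≐ FV (lam x M)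
dom-lam x M x∉xs xs⊆FV FV⊆x∷xs = to , from
  where
  to : ∀ y → y ∈ _ → y ∈ FV (lam x M)
  to y p = ∈-filter⁺ (λ z → ¬? (z ≟ x)) (xs⊆FV y p) (λ { refl → x∉xs p })

  from : ∀ y → y ∈ FV (lam x M) → y ∈ _
  from y p with ∈-filter⁻ (λ z → ¬? (z ≟ x)) {xs = FV M} p
  ... | q , y≢x with FV⊆x∷xs y q
  ...   | here y≡x = ⊥-elim (y≢x y≡x)
  ...   | there r  = r

dom-typing : ∀ {M Φ} → M ∶ Φ → dom (Typing.env Φ) ≐ FV M
dom-typing ax                  = ≐-refl
dom-typing {M} ω-ty            = dom-envω M
dom-typing (→i {M} {x = x} x∉Γ d) with dom-typing d
... | f , g = dom-lam x M x∉Γ (λ y p → f y (there p)) g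
dom-typing (→i' {M} {x = x} d x∉Γ) with dom-typing d
... | f , g = dom-lam x M x∉Γ f (λ y p → there (g y p))
dom-typing (→e {Γ₁ = Γ₁} {Γ₂ = Γ₂} d e) =
  ≐-trans (dom-⊓ᴱ Γ₁ Γ₂) (≐-++ (dom-typing d) (dom-typing e))
dom-typing (⊓i d _)            = dom-typing d
dom-typing (sub d p)           = ≐-trans (≐-sym (dom-⊑ᵀ p)) (dom-typing d)

⊑-ω : ∀ {U} → U ⊑ ω
⊑-ω = ⊑-trans (⊑-refl (≈-sym ω-unit)) ⊑-⊓

⊑ᴱ-cons : ∀ {Γ Γ' x U} → x ∉ dom Γ → Γ ⊑ᴱ Γ' → ((x , U) ∷ Γ) ⊑ᴱ ((x , U) ∷ Γ')
⊑ᴱ-cons _ (⊑ᴱ-refl p) = ⊑ᴱ-refl (prep _ p)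
-- In the transitivity case freshness transfers to the middle environment,
-- and in the extension case the two heads are swapped around the step.
⊑ᴱ-cons x∉Γ (⊑ᴱ-trans p q) =
  ⊑ᴱ-trans (⊑ᴱ-cons x∉Γ p) (⊑ᴱ-cons (λ x∈ → x∉Γ (proj₂ (dom-⊑ᴱ p) _ x∈)) q)
⊑ᴱ-cons {x = x} {U} x∉Γ (⊑ᴱ-ext {Γ = Δ} {y} {U₁} {U₂} U₁⊑U₂ y∉Δ) =
  ⊑ᴱ-trans (⊑ᴱ-refl (swap (x , U) (y , U₁) ↭-refl))
  (⊑ᴱ-trans (⊑ᴱ-ext U₁⊑U₂ y∉x∷Δ)
            (⊑ᴱ-refl (swap (y , U₂) (x , U) ↭-refl)))
  where
  y∉x∷Δ : y ∉ x ∷ dom Δ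
  y∉x∷Δ (here y≡x) = x∉Γ (here (sym y≡x))
  y∉x∷Δ (there p)  = y∉Δ p

⊑ᴱ-ωify : ∀ Γ → Unique (dom Γ) → Γ ⊑ᴱ ωify (dom Γ)
⊑ᴱ-ωify []             _         = ⊑ᴱ-refl ↭-refl
⊑ᴱ-ωify ((x , U) ∷ Γ) (x∉ ∷ uΓ) =
  ⊑ᴱ-trans (⊑ᴱ-ext ⊑-ω x∉Γ) (⊑ᴱ-cons x∉Γ (⊑ᴱ-ωify Γ uΓ))
  where
  x∉Γ : x ∉ dom Γ
  x∉Γ = All¬⇒¬Any x∉

-- dom Γ and deduplicate (FV M) are duplicate-free lists with the same
-- elements, hence permutations of each other; so are their ω-erasures.
ωify-envω : ∀ {Γ} M → Unique (dom Γ) → dom Γ ≐ FV M → ωify (dom Γ) ↭ envω M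
ωify-envω {Γ} M uΓ (f , g) =
  map⁺ (λ x → (x , ω)) (∼bag⇒↭ (unique∧set⇒bag uΓ (deduplicate-! (FV M)) same))
  where
  same : ∀ {x} → (x ∈ dom Γ) ⇔ (x ∈ deduplicate _≟_ (FV M))
  same {x} = mk⇔ (λ p → ∈-deduplicate⁺ _≟_ (f x p))
                 (λ p → g x (∈-deduplicate⁻ _≟_ (FV M) p))

ω-typing : ∀ (Γ : Env) (M : Term) → Unique (dom Γ) → dom Γ ≐ FV M → M ∶ ⟨ Γ ⊢ ω ⟩
ω-typing Γ M uΓ Γ≐FV =
  sub ω-ty (⊑ᵀ-⊢ (⊑-refl ≈-refl)
                 (⊑ᴱ-trans (⊑ᴱ-ωify Γ uΓ) (⊑ᴱ-refl (ωify-envω M uΓ Γ≐FV))))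

lemma2p7 : (∀ {M Γ U} → M ∶ ⟨ Γ ⊢ U ⟩ → dom Γ ≐ FV M)
           × (∀ (Γ : Env) (M : Term) → Unique (dom Γ) → dom Γ ≐ FV M → M ∶ ⟨ Γ ⊢ ω ⟩)
lemma2p7 = dom-typing , ω-typing
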